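{- For any positive integer $h$ and any $S\in\{x,x+1\}\cup\mathcal{F}$, the polynomial $\sigma(S^{2h})$ is odd and square-free.
   Context: $\sigma(A)$ is the sum of all monic divisors of $A\in\mathbb{F}_2[x]$; so $\sigma(S^{2h})=1+S+\cdots+S^{2h}$ for $S$ irreducible. A polynomial is odd if it has no linear factor ($x$ or $x+1$). For $Q\in\mathbb{F}_2[x]$, $\overline{Q}(x)=Q(x+1)$. $\mathcal{F}=\{M_1,\ldots,M_{13},S_1,\ldots,S_{15}\}$ where $M_1=1+x+x^2$, $M_2=1+x+x^3$, $M_3=1+x^2+x^3$, $M_4=1+x+x^2+x^3+x^4$, $M_5=1+x^3+x^4$, $M_6=1+x^3+x^5$, $M_7=1+x^3+x^7$, $M_8=1+x^6+x^7$, $M_9=\overline{M_6}$, $M_{10}=\overline{M_7}$, $M_{11}=\overline{M_8}$, $M_{12}=1+x+x^9$, $M_{13}=1+x^8+x^9$, $S_1=1+x(x+1)M_1$, $S_2=1+x^2(x+1)^2M_1$, $S_3=1+x(x+1)^3M_1^4$, $S_4=1+x^3(x+1)M_1$, $S_5=1+x(x+1)^3M_1$, $S_6=1+x^3(x+1)M_1^4$, $S_7=1+x(x+1)M_1^3$, $S_8=1+x^3(x+1)^3M_1$, $S_9=1+x(x+1)M_1^5$, $S_{10}=1+x^4(x+1)M_1$, $S_{11}=1+x(x+1)^2M_1$, $S_{12}=1+x^2(x+1)M_1^2$, $S_{13}=1+x(x+1)^4M_1$, $S_{14}=1+x^2(x+1)M_1$, $S_{15}=1+x(x+1)^2M_1^2$;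 all are irreducible. -}

module Defs where

open import Data.Bool using (Bool; true; false; _xor_; if_then_else_)
open import Data.Nat using (ℕ; zero; suc; _≤_)
open import Data.List using (List; []; _∷_; _++_; replicate; length)
open import Data.Product using (Σ)
open import Relation.Binary.PropositionalEquality using (_≡_)
open import Relation.Nullary using (¬_)
open import Data.Product using (_×_)

-- Polynomials over F₂ as little-endian coefficient lists
-- (index i = coefficient of x^i); trailing zeros allowed.
Poly : Set
Poly = List Bool

infixl 6 _+ₚ_
infixl 7 _*ₚ_
infix 4 _≈ₚ_ _∣ₚ_

_+ₚ_ : Poly → Poly → Poly
[] +ₚ q = q
(a ∷ p) +ₚ [] = a ∷ p
(a ∷ p) +ₚ (b ∷ q) = (a xor b) ∷ (p +ₚ q)

scale : Bool → Poly → Poly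
scale true p = p
scale false p = []

_*ₚ_ : Poly → Poly → Poly
[] *ₚ q = []
(a ∷ p) *ₚ q = scale a q +ₚ (false ∷ (p *ₚ q))

consN : Bool → Poly → Poly
consN false [] = []
consN true  [] = true ∷ []
consN a (b ∷ r) = a ∷ b ∷ r

norm : Poly → Poly
norm [] = []
norm (a ∷ p) = consN a (norm p)

_≈ₚ_ : Poly → Poly → Set
p ≈ₚ q = norm p ≡ norm q

_∣ₚ_ : Poly → Poly → Set
a ∣ₚ b = Σ Poly (λ c → a *ₚ c ≈ₚ b)

one : Poly
one = true ∷ []

X : Poly
X = false ∷ true ∷ []

X1 : Poly
X1 = true ∷ true ∷ []

_^ₚ_ : Poly → ℕ → Poly
p ^ₚ zero = one
p ^ₚ suc n = p *ₚ (p ^ₚ n)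

NonConstant : Poly → Set
NonConstant p = 2 ≤ length (norm p)

Odd : Poly → Set
Odd p = ¬ (X ∣ₚ p) × ¬ (X1 ∣ₚ p)

SquareFree : Poly → Set
SquareFree p = (d : Poly) → NonConstant d → ¬ (d *ₚ d ∣ₚ p)

geom : Poly → ℕ → Poly
geom S zero = one
geom S (suc n) = geom S n +ₚ (S ^ₚ suc n)

-- σ(S^n) for S irreducible: 1 + S + ... + S^n
sigmaIrrPow : Poly → ℕ → Poly
sigmaIrrPow = geom

compose : Poly → Poly → Poly
compose [] r = []
compose (a ∷ p) r = scale a one +ₚ r *ₚ compose p r

bar : Poly → Poly
bar q = compose q X1

mono : ℕ → Poly
mono k = replicate k false ++ (true ∷ [])

fromExps : List ℕ → Poly
fromExps [] = []
fromExps (k ∷ ks) = mono k +ₚ fromExps ks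

M1 M2 M3 M4 M5 M6 M7 M8 M9 M10 M11 M12 M13 : Poly
M1 = fromExps (0 ∷ 1 ∷ 2 ∷ [])
M2 = fromExps (0 ∷ 1 ∷ 3 ∷ [])
M3 = fromExps (0 ∷ 2 ∷ 3 ∷ [])
M4 = fromExps (0 ∷ 1 ∷ 2 ∷ 3 ∷ 4 ∷ [])
M5 = fromExps (0 ∷ 3 ∷ 4 ∷ [])
M6 = fromExps (0 ∷ 3 ∷ 5 ∷ [])
M7 = fromExps (0 ∷ 3 ∷ 7 ∷ [])
M8 = fromExps (0 ∷ 6 ∷ 7 ∷ [])
M9 = bar M6
M10 = bar M7
M11 = bar M8
M12 = fromExps (0 ∷ 1 ∷ 9 ∷ [])
M13 = fromExps (0 ∷ 8 ∷ 9 ∷ [])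

sP : ℕ → ℕ → ℕ → Poly
sP a b c = one +ₚ (X ^ₚ a) *ₚ (X1 ^ₚ b) *ₚ (M1 ^ₚ c)

S1 S2 S3 S4 S5 S6 S7 S8 S9 S10 S11 S12 S13 S14 S15 : Poly
S1 = sP 1 1 1
S2 = sP 2 2 1
S3 = sP 1 3 4
S4 = sP 3 1 1
S5 = sP 1 3 1
S6 = sP 3 1 4
S7 = sP 1 1 3
S8 = sP 3 3 1
S9 = sP 1 1 5
S10 = sP 4 1 1
S11 = sP 1 2 1
S12 = sP 2 1 2
S13 = sP 1 4 1
S14 = sP 2 1 1
S15 = sP 1 2 2

-- {x, x+1} ∪ 𝓕
candidates : List Poly
candidates = X ∷ X1 ∷ M1 ∷ M2 ∷ M3 ∷ M4 ∷ M5 ∷ M6 ∷ M7 ∷ M8 ∷ M9 ∷ M10 ∷ M11 ∷ M12 ∷ M13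
  ∷ S1 ∷ S2 ∷ S3 ∷ S4 ∷ S5 ∷ S6 ∷ S7 ∷ S8 ∷ S9 ∷ S10 ∷ S11 ∷ S12 ∷ S13 ∷ S14 ∷ S15 ∷ []

-- Let f = 1 + s + ⋯ + s²ʰ and P = s(s + 1). Since P ∣ f + 1 and P vanishes at 0 and 1,
-- f takes the value 1 at both points, so it is odd. If d² ∣ f, then d divides f and f′;
-- differentiating f(s + 1) = s²ʰ⁺¹ + 1 in characteristic 2 gives (s + 1)f′ + s′f = s′s²ʰ,
-- so d divides s′s²ʰ, hence a power of P as soon as s′ does. As f ≡ 1 modulo P, d is then
-- a unit. Every candidate s satisfies s′ ∣ (s(s + 1))².
module Submission where

open import Defs
open import Algebra.Bundles using (CommutativeSemiring; CommutativeMonoid; CommutativeRing; RawRing)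
open import Algebra.Solver.Ring.AlmostCommutativeRing
  using (AlmostCommutativeRing; _-Raw-AlmostCommutative⟶_)
open import Data.Bool using (Bool; true; false; _xor_; _∧_)
open import Data.Bool.Properties
  using (xor-assoc; xor-comm; xor-same; xor-identityʳ; ∧-zeroʳ; ∧-assoc; ∧-distribˡ-xor; xor-∧-commutativeRing)
  renaming (_≟_ to _≟ᵇ_)
open import Data.List using ([]; _∷_; length)
open import Data.List.Membership.Propositional using (_∈_)
open import Data.List.Relation.Unary.All as All using (All; []; _∷_)
open import Data.Maybe using (Maybe; just; nothing)
open import Data.Nat using (ℕ; zero; suc; _+_; _*_; _≤_; _<_; _≥_; z≤n; s≤s; s≤s⁻¹)
import Data.Nat.Properties as ℕ
open import Data.Product using (_×_; _,_)
open import Data.Sum using (_⊎_; inj₁; inj₂)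
open import Level using (0ℓ)
open import Relation.Binary.PropositionalEquality
  using (_≡_; refl; sym; trans; cong; cong₂; subst; subst₂; isEquivalence; module ≡-Reasoning)
import Relation.Binary.Reasoning.Setoid
open import Relation.Nullary using (¬_; yes; no)

-- The commutative semiring F₂[x]

infix 4 _≋_

-- A record around _≈ₚ_, so that both sides can be inferred from a proof (norm is not injective).
record _≋_ (p q : Poly) : Set where
  constructor ⟪_⟫
  field ≋⇒≈ₚ : p ≈ₚ q
open _≋_ public

norm-consN : ∀ a p → norm (consN a p) ≡ consN a (norm p)
norm-consN false []      = refl
norm-consN true  []      = refl
norm-consN false (b ∷ p) = refl
norm-consN true  (b ∷ p) = refl

norm-idem : ∀ p → norm (norm p) ≡ norm p
norm-idem []      = refl
norm-idem (a ∷ p) = trans (norm-consN a (norm p)) (cong (consN a) (norm-idem p))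

≋-refl : ∀ {p} → p ≋ p
≋-refl = ⟪ refl ⟫

≋-sym : ∀ {p q} → p ≋ q → q ≋ p
≋-sym ⟪ e ⟫ = ⟪ sym e ⟫

≋-trans : ∀ {p q r} → p ≋ q → q ≋ r → p ≋ r
≋-trans ⟪ e ⟫ ⟪ f ⟫ = ⟪ trans e f ⟫

≡⇒≋ : ∀ {p q} → p ≡ q → p ≋ q
≡⇒≋ e = ⟪ cong norm e ⟫

norm-≋ : ∀ p → norm p ≋ p
norm-≋ p = ⟪ norm-idem p ⟫

∷-cong : ∀ a {p q} → p ≋ q → a ∷ p ≋ a ∷ q
∷-cong a ⟪ e ⟫ = ⟪ cong (consN a) e ⟫

+-identityʳ : ∀ p → p +ₚ [] ≡ p
+-identityʳ []      = refl
+-identityʳ (a ∷ p) = refl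

+-comm : ∀ p q → p +ₚ q ≡ q +ₚ p
+-comm []      q       = sym (+-identityʳ q)
+-comm (a ∷ p) []      = refl
+-comm (a ∷ p) (b ∷ q) = cong₂ _∷_ (xor-comm a b) (+-comm p q)

+-assoc : ∀ p q r → (p +ₚ q) +ₚ r ≡ p +ₚ (q +ₚ r)
+-assoc []      q       r       = refl
+-assoc (a ∷ p) []      r       = refl
+-assoc (a ∷ p) (b ∷ q) []      = refl
+-assoc (a ∷ p) (b ∷ q) (c ∷ r) = cong₂ _∷_ (xor-assoc a b c) (+-assoc p q r)

+-≡-commutativeMonoid : CommutativeMonoid 0ℓ 0ℓ
+-≡-commutativeMonoid = record
  { isCommutativeMonoid = record
    { isMonoid = record
      { isSemigroup = record
        { isMagma  = record { isEquivalence = isEquivalence ; ∙-cong = cong₂ _+ₚ_ }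
        ; assoc    = +-assoc }
      ; identity = (λ _ → refl) , +-identityʳ }
    ; comm = +-comm } }

open import Algebra.Properties.CommutativeSemigroup
  (CommutativeMonoid.commutativeSemigroup +-≡-commutativeMonoid)
  using (interchange; x∙yz≈y∙xz)

norm-+ˡ : ∀ p q → norm (norm p +ₚ q) ≡ norm (p +ₚ q)
norm-+ˡ []      q       = refl
norm-+ˡ (a ∷ p) []      = trans (cong norm (+-identityʳ (consN a (norm p))))
                                (trans (norm-consN a (norm p)) (cong (consN a) (norm-idem p)))
norm-+ˡ (a ∷ p) (b ∷ q) = trans (step a (norm p)) (cong (consN (a xor b)) (norm-+ˡ p q))
  where
  step : ∀ a r → norm (consN a r +ₚ (b ∷ q)) ≡ consN (a xor b) (norm (r +ₚ q))
  step false []      = refl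
  step true  []      = refl
  step false (c ∷ r) = refl
  step true  (c ∷ r) = refl

+-congˡ : ∀ {p p′} q → p ≋ p′ → p +ₚ q ≋ p′ +ₚ q
+-congˡ {p} {p′} q ⟪ e ⟫ =
  ⟪ trans (sym (norm-+ˡ p q)) (trans (cong (λ r → norm (r +ₚ q)) e) (norm-+ˡ p′ q)) ⟫

+-congʳ : ∀ p {q q′} → q ≋ q′ → p +ₚ q ≋ p +ₚ q′
+-congʳ p {q} {q′} e = ≋-trans (≡⇒≋ (+-comm p q)) (≋-trans (+-congˡ p e) (≡⇒≋ (+-comm q′ p)))

+-cong : ∀ {p p′ q q′} → p ≋ p′ → q ≋ q′ → p +ₚ q ≋ p′ +ₚ q′
+-cong {p′ = p′} {q = q} e f = ≋-trans (+-congˡ q e) (+-congʳ p′ f)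

+-self : ∀ p → p +ₚ p ≋ []
+-self []      = ≋-refl
+-self (a ∷ p) = ≋-trans (∷-cong _ (+-self p)) ⟪ cong (λ b → consN b []) (xor-same a) ⟫

scale-distrib-xor : ∀ a b p → scale (a xor b) p ≋ scale a p +ₚ scale b p
scale-distrib-xor true  true  p = ≋-sym (+-self p)
scale-distrib-xor true  false p = ≡⇒≋ (sym (+-identityʳ p))
scale-distrib-xor false b     p = ≋-refl

scale-distrib-+ : ∀ a p q → scale a (p +ₚ q) ≡ scale a p +ₚ scale a q
scale-distrib-+ true  p q = refl
scale-distrib-+ false p q = refl

scale-cong : ∀ a {p q} → p ≋ q → scale a p ≋ scale a q
scale-cong true  e = e
scale-cong false e = ≋-refl

*-congʳ : ∀ p {q q′} → q ≋ q′ → p *ₚ q ≋ p *ₚ q′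
*-congʳ []      e = ≋-refl
*-congʳ (a ∷ p) e = +-cong (scale-cong a e) (∷-cong false (*-congʳ p e))

*-consN : ∀ a p q → consN a p *ₚ q ≋ (a ∷ p) *ₚ q
*-consN false []      q = ⟪ refl ⟫
*-consN true  []      q = ≋-refl
*-consN false (b ∷ p) q = ≋-refl
*-consN true  (b ∷ p) q = ≋-refl

*-norm : ∀ p q → norm p *ₚ q ≋ p *ₚ q
*-norm []      q = ≋-refl
*-norm (a ∷ p) q = ≋-trans (*-consN a (norm p) q) (+-congʳ (scale a q) (∷-cong false (*-norm p q)))

*-congˡ : ∀ {p p′} q → p ≋ p′ → p *ₚ q ≋ p′ *ₚ q
*-congˡ {p} {p′} q ⟪ e ⟫ = ≋-trans (≋-sym (*-norm p q)) (≋-trans (≡⇒≋ (cong (_*ₚ q) e)) (*-norm p′ q))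

*-cong : ∀ {p p′ q q′} → p ≋ p′ → q ≋ q′ → p *ₚ q ≋ p′ *ₚ q′
*-cong {p′ = p′} {q = q} e f = ≋-trans (*-congˡ q e) (*-congʳ p′ f)

*-zeroʳ : ∀ p → p *ₚ [] ≋ []
*-zeroʳ []          = ≋-refl
*-zeroʳ (true  ∷ p) = ≋-trans (∷-cong false (*-zeroʳ p)) ⟪ refl ⟫
*-zeroʳ (false ∷ p) = ≋-trans (∷-cong false (*-zeroʳ p)) ⟪ refl ⟫

*-identityˡ : ∀ p → one *ₚ p ≋ p
*-identityˡ p = ≋-trans (+-congʳ p {false ∷ []} ⟪ refl ⟫) (≡⇒≋ (+-identityʳ p))

*-identityʳ : ∀ p → p *ₚ one ≋ p
*-identityʳ []          = ≋-refl
*-identityʳ (true  ∷ p) = ∷-cong true  (*-identityʳ p)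
*-identityʳ (false ∷ p) = ∷-cong false (*-identityʳ p)

*-distribʳ-+ : ∀ r p q → (p +ₚ q) *ₚ r ≋ p *ₚ r +ₚ q *ₚ r
*-distribʳ-+ r []      q       = ≋-refl
*-distribʳ-+ r (a ∷ p) []      = ≡⇒≋ (sym (+-identityʳ _))
*-distribʳ-+ r (a ∷ p) (b ∷ q) =
  ≋-trans (+-cong (scale-distrib-xor a b r) (∷-cong false (*-distribʳ-+ r p q)))
          (≡⇒≋ (interchange (scale a r) (scale b r) (false ∷ p *ₚ r) (false ∷ q *ₚ r)))

*-distribˡ-+ : ∀ p q r → p *ₚ (q +ₚ r) ≋ p *ₚ q +ₚ p *ₚ r
*-distribˡ-+ []      q r = ≋-refl
*-distribˡ-+ (a ∷ p) q r =
  ≋-trans (+-cong (≡⇒≋ (scale-distrib-+ a q r)) (∷-cong false (*-distribˡ-+ p q r)))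
          (≡⇒≋ (interchange (scale a q) (scale a r) (false ∷ p *ₚ q) (false ∷ p *ₚ r)))

*-assoc : ∀ p q r → (p *ₚ q) *ₚ r ≋ p *ₚ (q *ₚ r)
*-assoc []      q r = ≋-refl
*-assoc (a ∷ p) q r =
  ≋-trans (*-distribʳ-+ r (scale a q) (false ∷ p *ₚ q))
          (+-cong (≡⇒≋ (scale-* a)) (∷-cong false (*-assoc p q r)))
  where
  scale-* : ∀ a → scale a q *ₚ r ≡ scale a (q *ₚ r)
  scale-* true  = refl
  scale-* false = refl

*-∷ʳ : ∀ p b q → p *ₚ (b ∷ q) ≋ scale b p +ₚ (false ∷ p *ₚ q)
*-∷ʳ []      true  q = ⟪ refl ⟫
*-∷ʳ []      false q = ⟪ refl ⟫
*-∷ʳ (a ∷ p) b     q =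
  ≋-trans (+-congʳ (scale a (b ∷ q)) (∷-cong false (*-∷ʳ p b q))) (≡⇒≋ (swap a b))
  where
  swap : ∀ a b → scale a (b ∷ q) +ₚ (false ∷ scale b p +ₚ (false ∷ p *ₚ q))
               ≡ scale b (a ∷ p) +ₚ (false ∷ scale a q +ₚ (false ∷ p *ₚ q))
  swap true  true  = cong (true ∷_) (x∙yz≈y∙xz q p (false ∷ p *ₚ q))
  swap true  false = refl
  swap false true  = refl
  swap false false = refl

*-comm : ∀ p q → p *ₚ q ≋ q *ₚ p
*-comm []      q = ≋-sym (*-zeroʳ q)
*-comm (a ∷ p) q = ≋-trans (+-congʳ (scale a q) (∷-cong false (*-comm p q))) (≋-sym (*-∷ʳ q a p))

+-*-commutativeSemiring : CommutativeSemiring 0ℓ 0ℓ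
+-*-commutativeSemiring = record
  { Carrier = Poly ; _≈_ = _≋_ ; _+_ = _+ₚ_ ; _*_ = _*ₚ_ ; 0# = [] ; 1# = one
  ; isCommutativeSemiring = record
    { isSemiring = record
      { isSemiringWithoutAnnihilatingZero = record
        { +-isCommutativeMonoid = record
          { isMonoid = record
            { isSemigroup = record
              { isMagma = record
                { isEquivalence = record { refl = ≋-refl ; sym = ≋-sym ; trans = ≋-trans }
                ; ∙-cong        = +-cong }
              ; assoc = λ p q r → ≡⇒≋ (+-assoc p q r) }
            ; identity = (λ _ → ≋-refl) , (λ p → ≡⇒≋ (+-identityʳ p)) }
          ; comm = λ p q → ≡⇒≋ (+-comm p q) }
        ; *-cong     = *-cong
        ; *-assoc    = *-assoc
        ; *-identity = *-identityˡ , *-identityʳ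
        ; distrib    = *-distribˡ-+ , *-distribʳ-+ }
      ; zero = (λ _ → ≋-refl) , *-zeroʳ }
    ; *-comm = *-comm } }

-- F₂[x] as a ring whose negation is the identity; the solver then works with
-- coefficients in F₂ and so knows that p + p = 0.
+-*-almostCommutativeRing : AlmostCommutativeRing 0ℓ 0ℓ
+-*-almostCommutativeRing = record
  { isAlmostCommutativeRing = record
    { isCommutativeSemiring = CommutativeSemiring.isCommutativeSemiring +-*-commutativeSemiring
    ; -‿cong       = λ e → e
    ; -‿*-distribˡ = λ _ _ → ≋-refl
    ; -‿+-comm     = λ _ _ → ≋-refl } }

𝔽₂-rawRing : RawRing 0ℓ 0ℓ
𝔽₂-rawRing = record
  { _≈_ = _≡_ ; _+_ = _xor_ ; _*_ = _∧_ ; -_ = λ a → a ; 0# = false ; 1# = true }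

constant : 𝔽₂-rawRing -Raw-AlmostCommutative⟶ +-*-almostCommutativeRing
constant = record
  { ⟦_⟧    = λ a → a ∷ []
  ; +-homo = λ _ _ → ≋-refl
  ; *-homo = *-homo
  ; -‿homo = λ _ → ≋-refl
  ; 0-homo = ⟪ refl ⟫
  ; 1-homo = ≋-refl }
  where
  *-homo : ∀ a b → (a ∧ b) ∷ [] ≋ (a ∷ []) *ₚ (b ∷ [])
  *-homo true  b = ⟪ cong (λ c → consN c []) (sym (xor-identityʳ b)) ⟫
  *-homo false b = ⟪ refl ⟫

constant-≟ : ∀ a b → Maybe (a ∷ [] ≋ b ∷ [])
constant-≟ a b with a ≟ᵇ b
... | yes refl = just ≋-refl
... | no _     = nothing

open import Algebra.Solver.Ring 𝔽₂-rawRing +-*-almostCommutativeRing constant constant-≟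
  using (solve; _:+_; _:*_; _:=_; con)

-- Divisibility and powers

open CommutativeSemiring +-*-commutativeSemiring using (semiring; *-commutativeSemigroup; setoid)
open import Algebra.Properties.Semiring.Divisibility semiring
  using (_∣_; _,_; _∣0; ∣ʳ-trans; ∣ʳ-respʳ-≈; x∣ʳy⇒x∣ʳzy)
open import Algebra.Properties.CommutativeSemigroup.Divisibility *-commutativeSemigroup
  using (x∣xy; ∙-cong-∣)
open import Algebra.Properties.CommutativeSemiring.Exp +-*-commutativeSemiring
  using (_^_; ^-homo-*; ^-distrib-*)
open import Algebra.Properties.CommutativeSemigroup
  (CommutativeRing.+-commutativeSemigroup xor-∧-commutativeRing)
  using () renaming (interchange to xor-interchange)
module ≋-Reasoning = Relation.Binary.Reasoning.Setoid setoid

∣-+ : ∀ {d p q} → d ∣ p → d ∣ q → d ∣ p +ₚ q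
∣-+ {d} (a , ad≋p) (b , bd≋q) = a +ₚ b , ≋-trans (*-distribʳ-+ d a b) (+-cong ad≋p bd≋q)

∣ₚ⇒∣ : ∀ {d p} → d ∣ₚ p → d ∣ p
∣ₚ⇒∣ {d} (c , dc≈p) = c , ≋-trans (*-comm c d) ⟪ dc≈p ⟫

^ₚ≡^ : ∀ p n → p ^ₚ n ≡ p ^ n
^ₚ≡^ p zero    = refl
^ₚ≡^ p (suc n) = cong (p *ₚ_) (^ₚ≡^ p n)

^ₚ-homo-* : ∀ p m n → p ^ₚ (m + n) ≋ p ^ₚ m *ₚ p ^ₚ n
^ₚ-homo-* p m n rewrite ^ₚ≡^ p (m + n) | ^ₚ≡^ p m | ^ₚ≡^ p n = ^-homo-* p m n

^ₚ-distrib-* : ∀ p q n → (p *ₚ q) ^ₚ n ≋ p ^ₚ n *ₚ q ^ₚ n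
^ₚ-distrib-* p q n rewrite ^ₚ≡^ (p *ₚ q) n | ^ₚ≡^ p n | ^ₚ≡^ q n = ^-distrib-* p q n

^ₚ-double : ∀ p n → p ^ₚ (2 * n) ≋ p ^ₚ n *ₚ p ^ₚ n
^ₚ-double p n = ≋-trans (^ₚ-homo-* p n (n + 0)) (*-congʳ (p ^ₚ n) (≡⇒≋ (cong (p ^ₚ_) (ℕ.+-identityʳ n))))

^ₚ-∣-^ₚ : ∀ p q n → p ^ₚ n ∣ (p *ₚ q) ^ₚ n
^ₚ-∣-^ₚ p q n = q ^ₚ n , ≋-trans (*-comm (q ^ₚ n) (p ^ₚ n)) (≋-sym (^ₚ-distrib-* p q n))

-- Degree

-- One more than the degree, and 0 for the zero polynomial.
len : Poly → ℕ
len p = length (norm p)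

len-cong : ∀ {p q} → p ≋ q → len p ≡ len q
len-cong ⟪ e ⟫ = cong length e

≋[]⊎len>0 : ∀ p → p ≋ [] ⊎ 1 ≤ len p
≋[]⊎len>0 p with norm p in eq
... | []    = inj₁ ⟪ eq ⟫
... | _ ∷ _ = inj₂ (s≤s z≤n)

len-∷ : ∀ a p → 1 ≤ len p → len (a ∷ p) ≡ suc (len p)
len-∷ a p len>0 with norm p
len-∷ false p _ | _ ∷ _ = refl
len-∷ true  p _ | _ ∷ _ = refl

len-∷-≤ : ∀ a p → len (a ∷ p) ≤ suc (len p)
len-∷-≤ a p with norm p
len-∷-≤ false p | []    = z≤n
len-∷-≤ true  p | []    = s≤s z≤n
len-∷-≤ false p | _ ∷ _ = ℕ.≤-refl
len-∷-≤ true  p | _ ∷ _ = ℕ.≤-refl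

len-scale-≤ : ∀ a p → len (scale a p) ≤ len p
len-scale-≤ true  p = ℕ.≤-refl
len-scale-≤ false p = z≤n

len-+-< : ∀ p q → len p < len q → len (p +ₚ q) ≡ len q
len-+-< []      q       _  = refl
len-+-< (a ∷ p) (b ∷ q) lt with ≋[]⊎len>0 (a ∷ p)
... | inj₁ ap≋[] = len-cong (+-congˡ (b ∷ q) ap≋[])
... | inj₂ ap>0  = begin
  len ((a xor b) ∷ p +ₚ q) ≡⟨ len-∷ (a xor b) (p +ₚ q) (subst (1 ≤_) (sym IH) q>0) ⟩
  suc (len (p +ₚ q))       ≡⟨ cong suc IH ⟩
  suc (len q)              ≡⟨ len-∷ b q q>0 ⟨
  len (b ∷ q)              ∎
  where
  open ≡-Reasoning
  q>0 : 1 ≤ len q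
  q>0 = s≤s⁻¹ (ℕ.≤-trans (ℕ.≤-<-trans ap>0 lt) (len-∷-≤ b q))
  p<q : len p < len q
  p<q with ≋[]⊎len>0 p
  ... | inj₁ p≋[] = subst (_< len q) (sym (len-cong p≋[])) q>0
  ... | inj₂ p>0  = s≤s⁻¹ (subst₂ _<_ (len-∷ a p p>0) (len-∷ b q q>0) lt)
  IH : len (p +ₚ q) ≡ len q
  IH = len-+-< p q p<q

len-* : ∀ p q → 1 ≤ len p → 1 ≤ len q → suc (len (p *ₚ q)) ≡ len p + len q
len-* (a ∷ p) q ap>0 q>0 with ≋[]⊎len>0 p
len-* (false ∷ p) q ap>0 q>0 | inj₁ p≋[] with () ← subst (1 ≤_) (len-cong (∷-cong false p≋[])) ap>0
len-* (true  ∷ p) q ap>0 q>0 | inj₁ p≋[] =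
  trans (cong suc (len-cong (≋-trans (*-congˡ q (∷-cong true p≋[])) (*-identityˡ q))))
        (cong (_+ len q) (sym (len-cong (∷-cong true p≋[]))))
len-* (a ∷ p) q ap>0 q>0 | inj₂ p>0 = begin
  suc (len ((a ∷ p) *ₚ q))  ≡⟨ cong suc (len-+-< (scale a q) (false ∷ p *ₚ q) scale<) ⟩
  suc (len (false ∷ p *ₚ q)) ≡⟨ cong suc (len-∷ false (p *ₚ q) pq>0) ⟩
  suc (suc (len (p *ₚ q)))  ≡⟨ cong suc IH ⟩
  suc (len p + len q)       ≡⟨ cong (_+ len q) (len-∷ a p p>0) ⟨
  len (a ∷ p) + len q       ∎
  where
  open ≡-Reasoning
  IH : suc (len (p *ₚ q)) ≡ len p + len q
  IH = len-* p q p>0 q>0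
  pq>0 : 1 ≤ len (p *ₚ q)
  pq>0 = s≤s⁻¹ (subst (2 ≤_) (sym IH) (ℕ.+-mono-≤ p>0 q>0))
  scale< : len (scale a q) < len (false ∷ p *ₚ q)
  scale< = ℕ.≤-<-trans (len-scale-≤ a q)
             (subst (len q <_) (trans (sym IH) (sym (len-∷ false (p *ₚ q) pq>0))) (ℕ.m<n+m (len q) p>0))

∣one⇒¬NonConstant : ∀ {d} → d ∣ one → ¬ NonConstant d
∣one⇒¬NonConstant {d} (c , c*d≋1) d>1 with ≋[]⊎len>0 c
... | inj₁ c≋[] with () ← len-cong (≋-trans (≋-sym (*-congˡ d c≋[])) c*d≋1)
... | inj₂ c>0  = ℕ.<-irrefl refl (subst (3 ≤_) len-c+len-d≡2 (ℕ.+-mono-≤ c>0 d>1))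
  where
  len-c+len-d≡2 : len c + len d ≡ 2
  len-c+len-d≡2 = trans (sym (len-* c d c>0 (ℕ.<⇒≤ d>1))) (cong suc (len-cong c*d≋1))

-- Evaluation at 0 and 1

eval : Bool → Poly → Bool
eval b []      = false
eval b (a ∷ p) = a xor (b ∧ eval b p)

eval-consN : ∀ b a p → eval b (consN a p) ≡ eval b (a ∷ p)
eval-consN b false []      = sym (∧-zeroʳ b)
eval-consN b true  []      = refl
eval-consN b false (c ∷ p) = refl
eval-consN b true  (c ∷ p) = refl

eval-norm : ∀ b p → eval b (norm p) ≡ eval b p
eval-norm b []      = refl
eval-norm b (a ∷ p) = trans (eval-consN b a (norm p)) (cong (λ e → a xor (b ∧ e)) (eval-norm b p))

eval-cong : ∀ b {p q} → p ≋ q → eval b p ≡ eval b q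
eval-cong b {p} {q} ⟪ e ⟫ = trans (sym (eval-norm b p)) (trans (cong (eval b) e) (eval-norm b q))

eval-one : ∀ b → eval b one ≡ true
eval-one b = cong (true xor_) (∧-zeroʳ b)

eval-+ : ∀ b p q → eval b (p +ₚ q) ≡ eval b p xor eval b q
eval-+ b []      q       = refl
eval-+ b (a ∷ p) []      = sym (xor-identityʳ _)
eval-+ b (a ∷ p) (c ∷ q) = trans (cong (λ e → (a xor c) xor (b ∧ e)) (eval-+ b p q))
  (trans (cong ((a xor c) xor_) (∧-distribˡ-xor b (eval b p) (eval b q)))
         (xor-interchange a c (b ∧ eval b p) (b ∧ eval b q)))

eval-scale : ∀ b a p → eval b (scale a p) ≡ a ∧ eval b p
eval-scale b true  p = refl
eval-scale b false p = refl

eval-* : ∀ b p q → eval b (p *ₚ q) ≡ eval b p ∧ eval b q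
eval-* b []      q = refl
eval-* b (a ∷ p) q = begin
  eval b (scale a q +ₚ (false ∷ p *ₚ q))          ≡⟨ eval-+ b (scale a q) (false ∷ p *ₚ q) ⟩
  eval b (scale a q) xor (b ∧ eval b (p *ₚ q))  ≡⟨ cong₂ (λ x y → x xor (b ∧ y)) (eval-scale b a q) (eval-* b p q) ⟩
  (a ∧ eq) xor (b ∧ (ep ∧ eq))                  ≡⟨ cong ((a ∧ eq) xor_) (∧-assoc b ep eq) ⟨
  (a ∧ eq) xor ((b ∧ ep) ∧ eq)                  ≡⟨ CommutativeRing.distribʳ xor-∧-commutativeRing eq a (b ∧ ep) ⟨
  (a xor (b ∧ ep)) ∧ eq                         ∎
  where
  open ≡-Reasoning
  ep = eval b p
  eq = eval b q

eval-s*[s+1] : ∀ b s → eval b (s *ₚ (s +ₚ one)) ≡ false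
eval-s*[s+1] b s rewrite eval-* b s (s +ₚ one) | eval-+ b s one | eval-one b with eval b s
... | true  = refl
... | false = refl

eval-∣ : ∀ b {q p} → q ∣ p → eval b q ≡ false → eval b p ≡ false
eval-∣ b {q} {p} (c , cq≋p) q₀ =
  trans (sym (eval-cong b cq≋p)) (trans (eval-* b c q) (trans (cong (eval b c ∧_) q₀) (∧-zeroʳ _)))

-- The formal derivative

-- (a + x p)′ = p + x p′
∂ : Poly → Poly
∂ []      = []
∂ (a ∷ p) = p +ₚ (false ∷ ∂ p)

X*p≋false∷p : ∀ p → X *ₚ p ≋ false ∷ p
X*p≋false∷p p = ∷-cong false (≋-trans (+-congʳ p {false ∷ []} ⟪ refl ⟫) (≡⇒≋ (+-identityʳ p)))

∂-consN : ∀ a p → ∂ (consN a p) ≋ ∂ (a ∷ p)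
∂-consN false []      = ⟪ refl ⟫
∂-consN true  []      = ≋-refl
∂-consN false (b ∷ p) = ≋-refl
∂-consN true  (b ∷ p) = ≋-refl

∂-norm : ∀ p → ∂ (norm p) ≋ ∂ p
∂-norm []      = ≋-refl
∂-norm (a ∷ p) = ≋-trans (∂-consN a (norm p)) (+-cong (norm-≋ p) (∷-cong false (∂-norm p)))

∂-cong : ∀ {p q} → p ≋ q → ∂ p ≋ ∂ q
∂-cong {p} {q} ⟪ e ⟫ = ≋-trans (≋-sym (∂-norm p)) (≋-trans (≡⇒≋ (cong ∂ e)) (∂-norm q))

∂-+ : ∀ p q → ∂ (p +ₚ q) ≋ ∂ p +ₚ ∂ q
∂-+ []      q       = ≋-refl
∂-+ (a ∷ p) []      = ≡⇒≋ (sym (+-identityʳ _))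
∂-+ (a ∷ p) (b ∷ q) = ≋-trans (+-congʳ (p +ₚ q) (∷-cong false (∂-+ p q)))
                              (≡⇒≋ (interchange p q (false ∷ ∂ p) (false ∷ ∂ q)))

∂-scale : ∀ a p → ∂ (scale a p) ≡ scale a (∂ p)
∂-scale true  p = refl
∂-scale false p = refl

∂-* : ∀ p q → ∂ (p *ₚ q) ≋ ∂ p *ₚ q +ₚ p *ₚ ∂ q
∂-* []      q = ≋-refl
∂-* (a ∷ p) q = begin
  ∂ (scale a q +ₚ (false ∷ p *ₚ q))
    ≈⟨ ∂-+ (scale a q) (false ∷ p *ₚ q) ⟩
  ∂ (scale a q) +ₚ (p *ₚ q +ₚ (false ∷ ∂ (p *ₚ q)))
    ≈⟨ +-cong (≡⇒≋ (∂-scale a q)) (+-congʳ (p *ₚ q) (≋-trans (∷-cong false (∂-* p q)) (≋-sym (X*p≋false∷p _)))) ⟩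
  scale a (∂ q) +ₚ (p *ₚ q +ₚ X *ₚ (∂ p *ₚ q +ₚ p *ₚ ∂ q))
    ≈⟨ regroup (scale a (∂ q)) p q X (∂ p) (∂ q) ⟩
  (p +ₚ X *ₚ ∂ p) *ₚ q +ₚ (scale a (∂ q) +ₚ X *ₚ (p *ₚ ∂ q))
    ≈⟨ +-cong (*-congˡ q (+-congʳ p (X*p≋false∷p (∂ p)))) (+-congʳ (scale a (∂ q)) (X*p≋false∷p _)) ⟩
  ∂ (a ∷ p) *ₚ q +ₚ (a ∷ p) *ₚ ∂ q
    ∎
  where
  open ≋-Reasoning
  regroup : ∀ s p q x p′ q′ → s +ₚ (p *ₚ q +ₚ x *ₚ (p′ *ₚ q +ₚ p *ₚ q′))
                             ≋ (p +ₚ x *ₚ p′) *ₚ q +ₚ (s +ₚ x *ₚ (p *ₚ q′))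
  regroup = solve 6 (λ s p q x p′ q′ → s :+ (p :* q :+ x :* (p′ :* q :+ p :* q′))
                                     := (p :+ x :* p′) :* q :+ (s :+ x :* (p :* q′))) ≋-refl

∂-+one : ∀ p → ∂ (p +ₚ one) ≋ ∂ p
∂-+one p = ≋-trans (∂-+ p one) (≋-trans (+-congʳ (∂ p) {∂ one} ⟪ refl ⟫) (≡⇒≋ (+-identityʳ (∂ p))))

-- In characteristic 2 squares have derivative zero, so they behave as constants.
∂-*-square : ∀ p q → ∂ (p *ₚ (q *ₚ q)) ≋ ∂ p *ₚ (q *ₚ q)
∂-*-square p q = begin
  ∂ (p *ₚ (q *ₚ q))                     ≈⟨ ∂-* p (q *ₚ q) ⟩
  ∂ p *ₚ (q *ₚ q) +ₚ p *ₚ ∂ (q *ₚ q)    ≈⟨ +-congʳ (∂ p *ₚ (q *ₚ q)) (*-congʳ p (∂-* q q)) ⟩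
  ∂ p *ₚ (q *ₚ q) +ₚ p *ₚ (∂ q *ₚ q +ₚ q *ₚ ∂ q)
    ≈⟨ solve 4 (λ p′ p q q′ → p′ :* (q :* q) :+ p :* (q′ :* q :+ q :* q′) := p′ :* (q :* q))
               ≋-refl (∂ p) p q (∂ q) ⟩
  ∂ p *ₚ (q *ₚ q)                       ∎
  where open ≋-Reasoning

*∣⇒∣∂ : ∀ {d p} → d *ₚ d ∣ p → d ∣ ∂ p
*∣⇒∣∂ {d} {p} (c , c*dd≋p) = ∂ c *ₚ d , (begin
  (∂ c *ₚ d) *ₚ d       ≈⟨ *-assoc (∂ c) d d ⟩
  ∂ c *ₚ (d *ₚ d)       ≈⟨ ∂-*-square c d ⟨
  ∂ (c *ₚ (d *ₚ d))     ≈⟨ ∂-cong c*dd≋p ⟩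
  ∂ p                   ∎)
  where open ≋-Reasoning

-- The sums σ(s²ʰ) = 1 + s + ⋯ + s²ʰ

geom-telescope : ∀ s n → geom s n *ₚ (s +ₚ one) ≋ s ^ₚ suc n +ₚ one
geom-telescope s zero    = solve 1 (λ s → con true :* (s :+ con true) := s :* con true :+ con true) ≋-refl s
geom-telescope s (suc n) = begin
  (geom s n +ₚ t) *ₚ (s +ₚ one)             ≈⟨ *-distribʳ-+ (s +ₚ one) (geom s n) t ⟩
  geom s n *ₚ (s +ₚ one) +ₚ t *ₚ (s +ₚ one) ≈⟨ +-congˡ (t *ₚ (s +ₚ one)) (geom-telescope s n) ⟩
  (t +ₚ one) +ₚ t *ₚ (s +ₚ one)
    ≈⟨ solve 2 (λ s t → (t :+ con true) :+ t :* (s :+ con true) := s :* t :+ con true) ≋-refl s t ⟩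
  s *ₚ t +ₚ one                             ∎
  where
  open ≋-Reasoning
  t = s ^ₚ suc n

geom-even-+one : ∀ s h → s *ₚ (s +ₚ one) ∣ geom s (2 * h) +ₚ one
geom-even-+one s zero    = ∣ʳ-respʳ-≈ ⟪ refl ⟫ (P ∣0)
  where P = s *ₚ (s +ₚ one)
geom-even-+one s (suc h) = subst (λ n → P ∣ geom s n +ₚ one) (sym (ℕ.*-suc 2 h))
                                 (step (2 * h) (geom-even-+one s h))
  where
  open ≋-Reasoning
  P = s *ₚ (s +ₚ one)
  step : ∀ m → P ∣ geom s m +ₚ one → P ∣ geom s (suc (suc m)) +ₚ one
  step m (k , k*P≋g+1) = k +ₚ t , (begin
    (k +ₚ t) *ₚ P                ≈⟨ *-distribʳ-+ P k t ⟩
    k *ₚ P +ₚ t *ₚ P             ≈⟨ +-congˡ (t *ₚ P) k*P≋g+1 ⟩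
    (g +ₚ one) +ₚ t *ₚ P
      ≈⟨ solve 3 (λ s g t → (g :+ con true) :+ t :* (s :* (s :+ con true))
                          := ((g :+ s :* t) :+ s :* (s :* t)) :+ con true) ≋-refl s g t ⟩
    ((g +ₚ s *ₚ t) +ₚ s *ₚ (s *ₚ t)) +ₚ one ∎)
    where
    g = geom s m
    t = s ^ₚ m

-- If k b = a + 1, then z = k b satisfies 1 = zⁿ + a (1 + z + ⋯ + zⁿ⁻¹) in characteristic 2,
-- and d divides both terms.
∣a∧∣bⁿ∧b∣a+1⇒∣one : ∀ {d a b} n → d ∣ a → d ∣ b ^ₚ n → b ∣ a +ₚ one → d ∣ one
∣a∧∣bⁿ∧b∣a+1⇒∣one zero    _   d∣1  _                           = d∣1
∣a∧∣bⁿ∧b∣a+1⇒∣one {d} {a} {b} (suc n) d∣a d∣bⁿ (k , kb≋a+1) =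
  ∣ʳ-respʳ-≈ one≋ (∣-+ d∣zⁿ (x∣ʳy⇒x∣ʳzy (geom z n) d∣a))
  where
  open ≋-Reasoning
  z = k *ₚ b
  d∣zⁿ : d ∣ z ^ₚ suc n
  d∣zⁿ = ∣ʳ-respʳ-≈ (≋-sym (^ₚ-distrib-* k b (suc n))) (x∣ʳy⇒x∣ʳzy (k ^ₚ suc n) d∣bⁿ)
  z+1≋a : z +ₚ one ≋ a
  z+1≋a = ≋-trans (+-congˡ one kb≋a+1) (solve 1 (λ a → (a :+ con true) :+ con true := a) ≋-refl a)
  one≋ : z ^ₚ suc n +ₚ geom z n *ₚ a ≋ one
  one≋ = begin
    z ^ₚ suc n +ₚ geom z n *ₚ a            ≈⟨ +-congʳ (z ^ₚ suc n) (*-congʳ (geom z n) z+1≋a) ⟨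
    z ^ₚ suc n +ₚ geom z n *ₚ (z +ₚ one)   ≈⟨ +-congʳ (z ^ₚ suc n) (geom-telescope z n) ⟩
    z ^ₚ suc n +ₚ (z ^ₚ suc n +ₚ one)      ≈⟨ solve 1 (λ w → w :+ (w :+ con true) := con true) ≋-refl (z ^ₚ suc n) ⟩
    one                                    ∎

-- Differentiating (1 + s + ⋯ + s²ʰ)(s + 1) = s²ʰ⁺¹ + 1.
∂-geom-even : ∀ s h → (s +ₚ one) *ₚ ∂ (geom s (2 * h)) +ₚ ∂ s *ₚ geom s (2 * h) ≋ ∂ s *ₚ s ^ₚ (2 * h)
∂-geom-even s h = begin
  (s +ₚ one) *ₚ ∂ f +ₚ ∂ s *ₚ f          ≈⟨ +-cong (*-comm (s +ₚ one) (∂ f)) (*-congˡ f (≋-sym (∂-+one s))) ⟩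
  ∂ f *ₚ (s +ₚ one) +ₚ ∂ (s +ₚ one) *ₚ f ≈⟨ +-congʳ (∂ f *ₚ (s +ₚ one)) (*-comm (∂ (s +ₚ one)) f) ⟩
  ∂ f *ₚ (s +ₚ one) +ₚ f *ₚ ∂ (s +ₚ one) ≈⟨ ∂-* f (s +ₚ one) ⟨
  ∂ (f *ₚ (s +ₚ one))                    ≈⟨ ∂-cong (geom-telescope s (2 * h)) ⟩
  ∂ (s *ₚ s ^ₚ (2 * h) +ₚ one)           ≈⟨ ∂-+one (s *ₚ s ^ₚ (2 * h)) ⟩
  ∂ (s *ₚ s ^ₚ (2 * h))                  ≈⟨ ∂-cong (*-congʳ s (^ₚ-double s h)) ⟩
  ∂ (s *ₚ (s ^ₚ h *ₚ s ^ₚ h))            ≈⟨ ∂-*-square s (s ^ₚ h) ⟩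
  ∂ s *ₚ (s ^ₚ h *ₚ s ^ₚ h)              ≈⟨ *-congʳ (∂ s) (^ₚ-double s h) ⟨
  ∂ s *ₚ s ^ₚ (2 * h)                    ∎
  where
  open ≋-Reasoning
  f = geom s (2 * h)

eval-geom-even : ∀ s h b → eval b (geom s (2 * h)) ≡ true
eval-geom-even s h b = begin
  eval b f                          ≡⟨ eval-cong b (solve 1 (λ f → f := (f :+ con true) :+ con true) ≋-refl f) ⟩
  eval b ((f +ₚ one) +ₚ one)        ≡⟨ eval-+ b (f +ₚ one) one ⟩
  eval b (f +ₚ one) xor eval b one  ≡⟨ cong₂ _xor_ (eval-∣ b (geom-even-+one s h) (eval-s*[s+1] b s)) (eval-one b) ⟩
  true                              ∎
  where
  open ≡-Reasoning
  f = geom s (2 * h)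

Odd-geom-even : ∀ s h → Odd (geom s (2 * h))
Odd-geom-even s h = root-free false X refl , root-free true X1 refl
  where
  f = geom s (2 * h)
  root-free : ∀ b r → eval b r ≡ false → ¬ (r ∣ₚ f)
  root-free b r r₀ r∣f with () ← trans (sym (eval-geom-even s h b)) (eval-∣ b (∣ₚ⇒∣ {r} {f} r∣f) r₀)

SquareFree-geom-even : ∀ s k → ∂ s ∣ (s *ₚ (s +ₚ one)) ^ₚ k → ∀ h → SquareFree (geom s (2 * h))
SquareFree-geom-even s k ∂s∣Pᵏ h d d-nonconstant dd∣ₚf =
  ∣one⇒¬NonConstant (∣a∧∣bⁿ∧b∣a+1⇒∣one (k + 2 * h) d∣f d∣Pᵏ⁺²ʰ (geom-even-+one s h)) d-nonconstant
  where
  f = geom s (2 * h)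
  P = s *ₚ (s +ₚ one)
  dd∣f : d *ₚ d ∣ f
  dd∣f = ∣ₚ⇒∣ dd∣ₚf
  d∣f : d ∣ f
  d∣f = ∣ʳ-trans (x∣xy d d) dd∣f
  d∣∂s*s²ʰ : d ∣ ∂ s *ₚ s ^ₚ (2 * h)
  d∣∂s*s²ʰ = ∣ʳ-respʳ-≈ (∂-geom-even s h)
               (∣-+ (x∣ʳy⇒x∣ʳzy (s +ₚ one) (*∣⇒∣∂ dd∣f)) (x∣ʳy⇒x∣ʳzy (∂ s) d∣f))
  d∣Pᵏ⁺²ʰ : d ∣ P ^ₚ (k + 2 * h)
  d∣Pᵏ⁺²ʰ = ∣ʳ-trans d∣∂s*s²ʰ
              (∣ʳ-respʳ-≈ (≋-sym (^ₚ-homo-* P k (2 * h)))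
                          (∙-cong-∣ ∂s∣Pᵏ (^ₚ-∣-^ₚ s (s +ₚ one) (2 * h))))

-- The quotients (s (s + 1))² / s′, in the order of the list of candidates.
candidates-∂∣[s*[s+1]]² : All (λ s → ∂ s ∣ (s *ₚ (s +ₚ one)) ^ₚ 2) candidates
candidates-∂∣[s*[s+1]]² =
    (fromExps (2 ∷ 4 ∷ []) , ⟪ refl ⟫)
  ∷ (fromExps (2 ∷ 4 ∷ []) , ⟪ refl ⟫)
  ∷ (fromExps (2 ∷ 8 ∷ []) , ⟪ refl ⟫)
  ∷ (fromExps (2 ∷ 6 ∷ 8 ∷ 10 ∷ []) , ⟪ refl ⟫)
  ∷ (fromExps (2 ∷ 4 ∷ 6 ∷ 10 ∷ []) , ⟪ refl ⟫)
  ∷ (fromExps (2 ∷ 4 ∷ 12 ∷ 14 ∷ []) , ⟪ refl ⟫)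
  ∷ (fromExps (4 ∷ 6 ∷ 10 ∷ 14 ∷ []) , ⟪ refl ⟫)
  ∷ (fromExps (4 ∷ 6 ∷ 10 ∷ 12 ∷ 14 ∷ 16 ∷ []) , ⟪ refl ⟫)
  ∷ (fromExps (4 ∷ 8 ∷ 10 ∷ 14 ∷ 18 ∷ 22 ∷ []) , ⟪ refl ⟫)
  ∷ (fromExps (6 ∷ 8 ∷ 18 ∷ 22 ∷ []) , ⟪ refl ⟫)
  ∷ (fromExps (2 ∷ 8 ∷ 14 ∷ 16 ∷ []) , ⟪ refl ⟫)
  ∷ (fromExps (4 ∷ 8 ∷ 12 ∷ 14 ∷ 20 ∷ 22 ∷ []) , ⟪ refl ⟫)
  ∷ (fromExps (2 ∷ 8 ∷ 20 ∷ 22 ∷ []) , ⟪ refl ⟫)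
  ∷ (fromExps (2 ∷ 4 ∷ 10 ∷ 12 ∷ 20 ∷ 28 ∷ []) , ⟪ refl ⟫)
  ∷ (fromExps (8 ∷ 10 ∷ 24 ∷ 28 ∷ []) , ⟪ refl ⟫)
  ∷ (fromExps (2 ∷ 4 ∷ 8 ∷ 16 ∷ []) , ⟪ refl ⟫)
  ∷ (fromExps (2 ∷ 6 ∷ 18 ∷ 20 ∷ []) , ⟪ refl ⟫)
  ∷ (fromExps (2 ∷ 4 ∷ 6 ∷ 8 ∷ 10 ∷ 12 ∷ 28 ∷ 30 ∷ 32 ∷ 34 ∷ 36 ∷ 38 ∷ []) , ⟪ refl ⟫)
  ∷ (fromExps (4 ∷ 22 ∷ []) , ⟪ refl ⟫)
  ∷ (fromExps (2 ∷ 6 ∷ 16 ∷ 18 ∷ 20 ∷ 22 ∷ []) , ⟪ refl ⟫)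
  ∷ (fromExps (4 ∷ 6 ∷ 8 ∷ 12 ∷ 14 ∷ 18 ∷ 22 ∷ 26 ∷ 30 ∷ 38 ∷ []) , ⟪ refl ⟫)
  ∷ (fromExps (2 ∷ 8 ∷ 12 ∷ 14 ∷ 18 ∷ 22 ∷ 26 ∷ 28 ∷ []) , ⟪ refl ⟫)
  ∷ (fromExps (4 ∷ 6 ∷ 14 ∷ 16 ∷ 22 ∷ 24 ∷ 26 ∷ 28 ∷ []) , ⟪ refl ⟫)
  ∷ (fromExps (2 ∷ 4 ∷ 6 ∷ 10 ∷ 12 ∷ 16 ∷ 20 ∷ 24 ∷ 36 ∷ 40 ∷ []) , ⟪ refl ⟫)
  ∷ (fromExps (2 ∷ 8 ∷ 10 ∷ 22 ∷ []) , ⟪ refl ⟫)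
  ∷ (fromExps (2 ∷ 6 ∷ 16 ∷ []) , ⟪ refl ⟫)
  ∷ (fromExps (2 ∷ 6 ∷ 10 ∷ 18 ∷ 20 ∷ 22 ∷ []) , ⟪ refl ⟫)
  ∷ (fromExps (2 ∷ 4 ∷ 6 ∷ 10 ∷ 16 ∷ 18 ∷ 20 ∷ 22 ∷ []) , ⟪ refl ⟫)
  ∷ (fromExps (0 ∷ 4 ∷ 6 ∷ 16 ∷ []) , ⟪ refl ⟫)
  ∷ (fromExps (2 ∷ 4 ∷ 8 ∷ 10 ∷ 16 ∷ 22 ∷ []) , ⟪ refl ⟫)
  ∷ []

lemma2p13 : (h : ℕ) → h ≥ 1 → (S : Poly) → S ∈ candidates →
    Odd (sigmaIrrPow S (2 * h)) × SquareFree (sigmaIrrPow S (2 * h))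
lemma2p13 h _ S S∈candidates =
  Odd-geom-even S h , SquareFree-geom-even S 2 (All.lookup candidates-∂∣[s*[s+1]]² S∈candidates) h
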